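{- Let $\alpha, \beta, \gamma$ be ordinals and $m > 1$ a natural number. Then: (i) if $\gamma$ is infinite, then $\alpha \not\equiv_4 \beta + \omega^m + \gamma^*$; (ii) if $\beta$ is infinite, then $\alpha \not\equiv_4 \beta + (\omega^*)^m + \gamma^*$.
   Context: For a linear order $X$, $X^*$ is its reverse; $\omega^m$ is the ordinal power and $(\omega^*)^m$ its reverse; $+$ is concatenation. For $n \ge 1$, $X \equiv_n Y$ means player II has a winning strategy in the $n$-move Ehrenfeucht–Fraïssé game on the linear orders $X$ and $Y$. -}

module Defs where

open import Level using (0ℓ)
open import Data.Nat using (ℕ; zero; suc; _>_)
import Data.Nat as ℕ
open import Data.Fin using (Fin)
open import Data.Vec using (Vec; []; _∷_)
open import Data.List using (List; []; _∷_)
open import Data.List.Relation.Unary.All using (All)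
open import Data.Product using (_×_; _,_; ∃; Σ)
open import Data.Sum using (_⊎_; inj₁; inj₂)
open import Data.Empty using (⊥)
open import Data.Unit using (⊤)
open import Relation.Binary using (Rel; IsStrictTotalOrder)
open import Relation.Binary.PropositionalEquality using (_≡_)
open import Induction.WellFounded using (WellFounded)
open import Function.Bundles using (_⇔_; _↔_)
open import Relation.Nullary using (¬_)

record LinOrd : Set₁ where
  constructor mkLO
  field
    Carrier : Set
    _<_     : Rel Carrier 0ℓ
open LinOrd public

IsOrdinal : LinOrd → Set
IsOrdinal X = IsStrictTotalOrder {A = Carrier X} _≡_ (_<_ X) × WellFounded (_<_ X)

Finite : LinOrd → Set
Finite X = ∃ λ n → Carrier X ↔ Fin n

Infinite : LinOrd → Set
Infinite X = ¬ Finite X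

rev : LinOrd → LinOrd
rev X = mkLO (Carrier X) (λ a b → _<_ X b a)

data SumLt (X Y : LinOrd) : Rel (Carrier X ⊎ Carrier Y) 0ℓ where
  ₁<₁ : ∀ {a b} → _<_ X a b → SumLt X Y (inj₁ a) (inj₁ b)
  ₁<₂ : ∀ {a b} → SumLt X Y (inj₁ a) (inj₂ b)
  ₂<₂ : ∀ {a b} → _<_ Y a b → SumLt X Y (inj₂ a) (inj₂ b)

_⊕_ : LinOrd → LinOrd → LinOrd
X ⊕ Y = mkLO (Carrier X ⊎ Carrier Y) (SumLt X Y)
infixl 6 _⊕_

Lex : ∀ {m} → Rel (Vec ℕ m) 0ℓ
Lex [] [] = ⊥
Lex (x ∷ xs) (y ∷ ys) = x ℕ.< y ⊎ (x ≡ y × Lex xs ys)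

-- The ordinal power ω^m, realised as m-digit sequences in lexicographic order
-- (the Cantor normal form coefficients ω^{m-1}·n₁ + … + n_m).
ω^ : ℕ → LinOrd
ω^ m = mkLO (Vec ℕ m) Lex

ω*^ : ℕ → LinOrd
ω*^ m = rev (ω^ m)

Position : LinOrd → LinOrd → Set
Position X Y = List (Carrier X × Carrier Y)

PartIso : (X Y : LinOrd) → Position X Y → Set
PartIso X Y p =
  All (λ { (a , b) → All (λ { (a' , b') →
        (_<_ X a a' ⇔ _<_ Y b b') × (a ≡ a' ⇔ b ≡ b') }) p }) p

IIWins : (X Y : LinOrd) → ℕ → Position X Y → Set
IIWins X Y zero p = PartIso X Y p
IIWins X Y (suc n) p =
  (∀ (x : Carrier X) → ∃ λ (y : Carrier Y) → IIWins X Y n ((x , y) ∷ p)) ×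
  (∀ (y : Carrier Y) → ∃ λ (x : Carrier X) → IIWins X Y n ((x , y) ∷ p))

_≡[_]_ : LinOrd → ℕ → LinOrd → Set
X ≡[ n ] Y = IIWins X Y n []

module Submission where

-- Everything rests on two "gap" patterns that player I can exploit
-- in the Ehrenfeucht–Fraïssé game: if a chosen pair (a , y) has a covered by an
-- immediate neighbour on one side while y has no immediate neighbour in the same
-- direction on the other side, then I wins in two further moves
-- (successorGap, predecessorGap; swapWins lets the neighbour be on either side).
-- Ordinals supply neighbours: above any non-maximal point there is an immediate
-- successor (coverAbove), and if every point is least or a successor then every
-- initial segment is finite (finiteUpTo).
--   (ii) In (ω*)^m, m ≥ 2, the point 1 0⋯0 has points above it but no immediate
--        successor, so noSuccessorGap applies.
--   (i)  Applied inside γ*, noSuccessorGap forces every point of γ to be least or a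
--        successor; γ being infinite, every point of γ then has an immediate
--        successor, i.e. every point of γ* ⊆ Y has an immediate predecessor.  In α
--        take the least l all of whose upper points are successors (it exists: II's
--        answer to the greatest point of Y is greatest in α).  Such l is a limit,
--        and II's answer to l either lies in γ* (predecessorGap) or lies below a
--        limit point c 0⋯0 of ω^m (belowLimit); both lose.

open import Defs
open import Data.Nat using (ℕ; _>_; zero; suc; s≤s; z≤n; _+_)
open import Data.Nat.Properties using (n<1+n)
open import Data.Product using (_×_; _,_; proj₁; proj₂; ∃; swap)
open import Data.Sum using (_⊎_; inj₁; inj₂)
open import Data.Empty using (⊥; ⊥-elim)
open import Data.Fin using (Fin; zero; suc)
open import Data.Vec using (Vec; []; _∷_; replicate)
open import Data.List using ([]; _∷_; map)
open import Data.List.Relation.Unary.All as All using (_∷_)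
open import Data.List.Relation.Unary.All.Properties using (map⁺)
open import Data.List.Relation.Unary.Any using (here; there)
open import Data.List.Membership.Propositional using (_∈_)
open import Relation.Binary using (IsStrictTotalOrder; tri<; tri≈; tri>)
open import Relation.Binary.PropositionalEquality using (_≡_; refl; sym; trans; cong)
open import Induction.WellFounded using (Acc; acc)
open import Function.Bundles using (_⇔_; Equivalence; mk↔ₛ′)
open import Function.Construct.Symmetry using (⇔-sym)
open import Relation.Nullary using (¬_)

open Equivalence using (to; from)

Between : (Z : LinOrd) → Carrier Z → Carrier Z → Set
Between Z a b = ∃ λ c → _<_ Z a c × _<_ Z c b

Covers : (Z : LinOrd) → Carrier Z → Carrier Z → Set
Covers Z a b = _<_ Z a b × ¬ Between Z a b

NoSuccessor : (Z : LinOrd) → Carrier Z → Set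
NoSuccessor Z y = ∀ w → _<_ Z y w → ¬ ¬ Between Z y w

NoPredecessor : (Z : LinOrd) → Carrier Z → Set
NoPredecessor Z y = ∀ p → _<_ Z p y → ¬ ¬ Between Z p y

SuccessorsAbove : (Z : LinOrd) → Carrier Z → Set
SuccessorsAbove Z x = ∀ y → _<_ Z x y → ¬ ¬ (∃ λ p → Covers Z p y)

IsLeast : (Z : LinOrd) → Carrier Z → Set
IsLeast Z g = ∀ x → ¬ _<_ Z x g

IsGreatest : (Z : LinOrd) → Carrier Z → Set
IsGreatest Z g = ∀ x → ¬ _<_ Z g x

module _ {X Y : LinOrd} where

  dropIso : ∀ {q p} → PartIso X Y (q ∷ p) → PartIso X Y p
  dropIso (_ ∷ rest) = All.map (λ { (_ ∷ t) → t }) rest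

  -- If II survives n more moves from p, then p itself is a partial isomorphism
  -- (let I play the remaining moves at an arbitrary point x, then forget them).
  partIsoOf : ∀ n {p} → Carrier X → IIWins X Y n p → PartIso X Y p
  partIsoOf zero    _ w = w
  partIsoOf (suc n) x w = dropIso (partIsoOf n x (proj₂ (proj₁ w x)))

  orderAgrees : ∀ {p a b a′ b′} → PartIso X Y p → (a , b) ∈ p → (a′ , b′) ∈ p →
                _<_ X a a′ ⇔ _<_ Y b b′
  orderAgrees iso i j = proj₁ (All.lookup (All.lookup iso i) j)

  swapWins : ∀ n {p} → IIWins X Y n p → IIWins Y X n (map swap p)
  swapWins zero    w = map⁺ (All.map (λ row → map⁺ (All.map (λ (lt , eq) → ⇔-sym lt , ⇔-sym eq) row)) w)
  swapWins (suc n) w =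
    (λ y → let (x , w′) = proj₂ w y in x , swapWins n w′) ,
    (λ x → let (y , w′) = proj₁ w x in y , swapWins n w′)

  -- If a is covered by s but y has no immediate successor, I wins two moves from
  -- (a , y): I plays s, II answers some w > y; I plays a point strictly between y
  -- and w, and II has no answer strictly between a and s.
  successorGap : ∀ n {p a s y} → Covers X a s → NoSuccessor Y y →
                 ¬ IIWins X Y (2 + n) ((a , y) ∷ p)
  successorGap n {s = s} {y} (a<s , nothingBetween) noSucc W =
    noSucc w y<w λ (z , y<z , z<w) → answerBetween z y<z z<w
    where
    w  = proj₁ (proj₁ W s)
    W′ = proj₂ (proj₁ W s)
    y<w = to (orderAgrees (partIsoOf (suc n) s W′) (there (here refl)) (here refl)) a<s
    answerBetween : ∀ z → _<_ Y y z → _<_ Y z w → ⊥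
    answerBetween z y<z z<w = nothingBetween (c , a<c , c<s)
      where
      c   = proj₁ (proj₂ W′ z)
      iso = partIsoOf n c (proj₂ (proj₂ W′ z))
      a<c = from (orderAgrees iso (there (there (here refl))) (here refl)) y<z
      c<s = from (orderAgrees iso (here refl) (there (here refl))) z<w

  predecessorGap : ∀ n {p q x y} → Covers X q x → NoPredecessor Y y →
                   ¬ IIWins X Y (2 + n) ((x , y) ∷ p)
  predecessorGap n {q = q} {y = y} (q<x , nothingBetween) noPred W =
    noPred w w<y λ (z , w<z , z<y) → answerBetween z w<z z<y
    where
    w  = proj₁ (proj₁ W q)
    W′ = proj₂ (proj₁ W q)
    w<y = to (orderAgrees (partIsoOf (suc n) q W′) (here refl) (there (here refl))) q<x
    answerBetween : ∀ z → _<_ Y w z → _<_ Y z y → ⊥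
    answerBetween z w<z z<y = nothingBetween (c , q<c , c<x)
      where
      c   = proj₁ (proj₂ W′ z)
      iso = partIsoOf n c (proj₂ (proj₂ W′ z))
      q<c = from (orderAgrees iso (there (here refl)) (here refl)) w<z
      c<x = from (orderAgrees iso (here refl) (there (there (here refl)))) z<y

  -- If every point above x is a successor while y lies below a point y′ without
  -- immediate predecessor, I wins three moves from (x , y): II must answer y′ by
  -- some x′ > x, which has an immediate predecessor, and predecessorGap applies.
  belowLimit : ∀ n {p x y y′} → SuccessorsAbove X x → _<_ Y y y′ → NoPredecessor Y y′ →
               ¬ IIWins X Y (3 + n) ((x , y) ∷ p)
  belowLimit n {y′ = y′} succAbove y<y′ noPred W =
    succAbove x′ x<x′ λ (_ , cov) → predecessorGap n cov noPred W′
    where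
    x′ = proj₁ (proj₂ W y′)
    W′ = proj₂ (proj₂ W y′)
    x<x′ = from (orderAgrees (partIsoOf (2 + n) x′ W′) (there (here refl)) (here refl)) y<y′

-- Facts about ordinals, stated double-negated where classical reasoning is used.
module Ordinal (X : LinOrd) (isX : IsOrdinal X) where
  open IsStrictTotalOrder (proj₁ isX) public using (compare)
  open IsStrictTotalOrder (proj₁ isX) using (irrefl) renaming (trans to <-trans)

  private
    _≺_ : Carrier X → Carrier X → Set
    _≺_ = _<_ X

  least : (P : Carrier X → Set) → ∀ {x} → P x →
          ¬ ¬ (∃ λ m → P m × (∀ y → y ≺ m → ¬ P y))
  least P {x} px refute = noneBelow x (proj₂ isX x) px
    where
    noneBelow : ∀ x → Acc _≺_ x → ¬ P x
    noneBelow x (acc rs) px = refute (x , px , λ y y<x → noneBelow y (rs y<x))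

  hasLeast : Carrier X → ¬ ¬ (∃ λ m → IsLeast X m)
  hasLeast x refute = least (λ _ → Carrier X) {x} x λ (m , _ , below) →
    refute (m , λ y y<m → below y y<m y)

  -- A point with something above it has an immediate successor: the least point above it.
  coverAbove : ∀ {a b} → a ≺ b → ¬ ¬ (∃ λ s → Covers X a s)
  coverAbove {a} a<b refute = least (a ≺_) a<b λ (s , a<s , below) →
    refute (s , a<s , λ (c , a<c , c<s) → below c c<s a<c)

  nonempty : Infinite X → ¬ ¬ Carrier X
  nonempty inf empty = inf (0 , mk↔ₛ′ (λ x → ⊥-elim (empty x)) (λ ()) (λ ()) (λ x → ⊥-elim (empty x)))

  _≼_ : Carrier X → Carrier X → Set
  x ≼ g = x ≺ g ⊎ x ≡ g

  record FiniteUpTo (g : Carrier X) : Set where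
    field
      size       : ℕ
      enum       : Fin size → Carrier X
      index      : Carrier X → Fin size
      enum≼      : ∀ i → enum i ≼ g
      index-enum : ∀ i → index (enum i) ≡ i
      enum-index : ∀ x → x ≼ g → enum (index x) ≡ x

  upToLeast : ∀ {g} → IsLeast X g → FiniteUpTo g
  upToLeast {g} isLeast = record
    { size = 1 ; enum = λ _ → g ; index = λ _ → zero ; enum≼ = λ _ → inj₂ refl
    ; index-enum = λ { zero → refl }
    ; enum-index = λ { x (inj₁ x<g) → ⊥-elim (isLeast x x<g) ; x (inj₂ x≡g) → sym x≡g } }

  upToSuccessor : ∀ {p g} → Covers X p g → FiniteUpTo p → FiniteUpTo g
  upToSuccessor {p} {g} (p<g , nothingBetween) S = record
    { size = suc size ; enum = enum′ ; index = index′
    ; enum≼ = λ { zero → inj₂ refl ; (suc i) → inj₁ (≼p→≺g (enum≼ i)) }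
    ; index-enum = λ { zero → index′-g
                     ; (suc i) → trans (index′-≺g (≼p→≺g (enum≼ i))) (cong suc (index-enum i)) }
    ; enum-index = λ { x (inj₂ refl) → cong enum′ index′-g
                     ; x (inj₁ x<g) → trans (cong enum′ (index′-≺g x<g)) (enum-index x (≺g→≼p x<g)) } }
    where
    open FiniteUpTo S

    ≼p→≺g : ∀ {x} → x ≼ p → x ≺ g
    ≼p→≺g (inj₁ x<p) = <-trans x<p p<g
    ≼p→≺g (inj₂ refl) = p<g

    ≺g→≼p : ∀ {x} → x ≺ g → x ≼ p
    ≺g→≼p {x} x<g with compare x p
    ... | tri< x<p _ _ = inj₁ x<p
    ... | tri≈ _ x≡p _ = inj₂ x≡p
    ... | tri> _ _ p<x = ⊥-elim (nothingBetween (x , p<x , x<g))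

    enum′ : Fin (suc size) → Carrier X
    enum′ zero    = g
    enum′ (suc i) = enum i

    index′ : Carrier X → Fin (suc size)
    index′ x with compare x g
    ... | tri≈ _ _ _ = zero
    ... | tri< _ _ _ = suc (index x)
    ... | tri> _ _ _ = suc (index x)

    index′-g : index′ g ≡ zero
    index′-g with compare g g
    ... | tri< g<g _ _ = ⊥-elim (irrefl refl g<g)
    ... | tri≈ _ _ _   = refl
    ... | tri> _ _ g<g = ⊥-elim (irrefl refl g<g)

    index′-≺g : ∀ {x} → x ≺ g → index′ x ≡ suc (index x)
    index′-≺g {x} x<g with compare x g
    ... | tri< _ _ _    = refl
    ... | tri≈ _ refl _ = ⊥-elim (irrefl refl x<g)
    ... | tri> _ _ g<x  = ⊥-elim (irrefl refl (<-trans x<g g<x))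

  -- If every point is least or a successor, every initial segment is finite
  -- (well-founded induction along immediate predecessors).
  finiteUpTo : (∀ g → ¬ ¬ (IsLeast X g ⊎ ∃ λ p → Covers X p g)) → ∀ g → ¬ ¬ FiniteUpTo g
  finiteUpTo leastOrSucc g = induct g (proj₂ isX g)
    where
    induct : ∀ g → Acc _≺_ g → ¬ ¬ FiniteUpTo g
    induct g (acc rs) refute = leastOrSucc g λ
      { (inj₁ isLeast) → refute (upToLeast isLeast)
      ; (inj₂ (p , cov)) → induct p (rs (proj₁ cov)) (λ S → refute (upToSuccessor cov S)) }

  finiteOf : ∀ {M} → FiniteUpTo M → IsGreatest X M → Finite X
  finiteOf {M} S isGreatest = size , mk↔ₛ′ index enum index-enum (λ x → enum-index x (≼M x))
    where
    open FiniteUpTo S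
    ≼M : ∀ x → x ≼ M
    ≼M x with compare x M
    ... | tri< x<M _ _ = inj₁ x<M
    ... | tri≈ _ x≡M _ = inj₂ x≡M
    ... | tri> _ _ M<x = ⊥-elim (isGreatest x M<x)

-- An ordinal is not 3-equivalent to an order with a point y that has points above it
-- but no immediate successor: II's answer a to y has a point above it (II's answer
-- to some z > y), hence an immediate successor, and successorGap applies.
noSuccessorGap : (α Y : LinOrd) → IsOrdinal α → ∀ n (y : Carrier Y) →
                 ¬ ¬ (∃ λ z → _<_ Y y z) → NoSuccessor Y y → ¬ (α ≡[ 3 + n ] Y)
noSuccessorGap α Y oα n y somethingAbove noSucc W = somethingAbove λ (z , y<z) →
  Ordinal.coverAbove α oα (a<answer z y<z) λ (_ , cov) → successorGap n cov noSucc W₁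
  where
  a  = proj₁ (proj₂ W y)
  W₁ = proj₂ (proj₂ W y)
  a<answer : ∀ z → _<_ Y y z → _<_ α a (proj₁ (proj₂ W₁ z))
  a<answer z y<z = from (orderAgrees (partIsoOf (suc n) b (proj₂ (proj₂ W₁ z))) (there (here refl)) (here refl)) y<z
    where b = proj₁ (proj₂ W₁ z)

zeros : ∀ n → Vec ℕ n
zeros n = replicate n 0

notBelowZeros : ∀ {n} (xs : Vec ℕ n) → ¬ Lex xs (zeros n)
notBelowZeros [] ()
notBelowZeros (x ∷ xs) (inj₁ ())
notBelowZeros (x ∷ xs) (inj₂ (_ , lt)) = notBelowZeros xs lt

bumpLast : ∀ {j} → Vec ℕ (suc j) → Vec ℕ (suc j)
bumpLast (x ∷ [])     = suc x ∷ []
bumpLast (x ∷ y ∷ ys) = x ∷ bumpLast (y ∷ ys)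

lex-bumpLast : ∀ {j} (xs : Vec ℕ (suc j)) → Lex xs (bumpLast xs)
lex-bumpLast (x ∷ [])     = inj₁ (n<1+n x)
lex-bumpLast (x ∷ y ∷ ys) = inj₂ (refl , lex-bumpLast (y ∷ ys))

-- For m ≥ 2, every point c ∷ 0⋯0 of ω^m is a limit: below it, r₀ ∷ rs (r₀ < c) is
-- followed by r₀ ∷ bumpLast rs, still below it.
lexLimit : ∀ {k} c (r : Vec ℕ (2 + k)) → Lex r (c ∷ zeros (suc k)) →
           Between (ω^ (2 + k)) r (c ∷ zeros (suc k))
lexLimit c (r₀ ∷ rs) (inj₁ r₀<c)    = (r₀ ∷ bumpLast rs) , inj₂ (refl , lex-bumpLast rs) , inj₁ r₀<c
lexLimit c (r₀ ∷ rs) (inj₂ (_ , lt)) = ⊥-elim (notBelowZeros rs lt)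

-- Part (ii): in (ω*)^m the point 1 0⋯0 has the point 0 0⋯0 above it but no
-- immediate successor.
partII : (α β γ : LinOrd) → IsOrdinal α → ∀ k → ¬ (α ≡[ 4 ] (β ⊕ ω*^ (2 + k) ⊕ rev γ))
partII α β γ oα k = noSuccessorGap α Y oα 1 y (λ refute → refute (z₀ , y<z₀)) noSucc
  where
  Y = β ⊕ ω*^ (2 + k) ⊕ rev γ
  y z₀ : Carrier Y
  y  = inj₁ (inj₂ (1 ∷ zeros (suc k)))
  z₀ = inj₁ (inj₂ (0 ∷ zeros (suc k)))
  y<z₀ : _<_ Y y z₀
  y<z₀ = ₁<₁ (₂<₂ (inj₁ (s≤s z≤n)))
  noSucc : NoSuccessor Y y
  noSucc (inj₁ (inj₂ w)) (₁<₁ (₂<₂ w<y)) refute =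
    let (q , w<q , q<y) = lexLimit 1 w w<y in refute (inj₁ (inj₂ q) , ₁<₁ (₂<₂ q<y) , ₁<₁ (₂<₂ w<q))
  noSucc (inj₂ _) ₁<₂ refute = refute (z₀ , y<z₀ , ₁<₂)

module PartI (α β γ : LinOrd) (oα : IsOrdinal α) (oγ : IsOrdinal γ) (k : ℕ)
             (infγ : Infinite γ) (W : α ≡[ 4 ] (β ⊕ ω^ (2 + k) ⊕ rev γ)) where
  Y : LinOrd
  Y = β ⊕ ω^ (2 + k) ⊕ rev γ

  module A = Ordinal α oα
  module G = Ordinal γ oγ

  -- Every point of γ is least or a successor: otherwise its copy in γ* ⊆ Y has
  -- points above it but no immediate successor, contradicting noSuccessorGap.
  leastOrSuccessor : ∀ g → ¬ ¬ (IsLeast γ g ⊎ ∃ λ p → Covers γ p g)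
  leastOrSuccessor g refute = noSuccessorGap α Y oα 1 (inj₂ g) somethingAbove noSucc W
    where
    somethingAbove : ¬ ¬ (∃ λ z → _<_ Y (inj₂ g) z)
    somethingAbove none = refute (inj₁ λ x x<g → none (inj₂ x , ₂<₂ x<g))
    noSucc : NoSuccessor Y (inj₂ g)
    noSucc (inj₂ h) (₂<₂ h<g) noneBetween = refute (inj₂ (h , h<g ,
      λ (q , h<q , q<g) → noneBetween (inj₂ q , ₂<₂ q<g , ₂<₂ h<q)))

  -- γ being infinite has no greatest point, so every point has an immediate successor.
  covered : ∀ h → ¬ ¬ (∃ λ h′ → Covers γ h h′)
  covered h refute = G.finiteUpTo leastOrSuccessor h λ S →
    infγ (G.finiteOf S λ x h<x → G.coverAbove h<x refute)

  coveredInY : ∀ {h h′} → Covers γ h h′ → Covers Y (inj₂ h′) (inj₂ h)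
  coveredInY (h<h′ , nothingBetween) =
    ₂<₂ h<h′ , λ { (inj₁ _ , () , _) ; (inj₂ x , ₂<₂ x<h′ , ₂<₂ h<x) → nothingBetween (x , h<x , x<h′) }

  -- Some point of α has only successors above it: II's answer to the greatest point
  -- of Y (the least point of γ) has nothing above it.
  someSuccessorsAbove : ¬ ¬ (∃ (SuccessorsAbove α))
  someSuccessorsAbove refute = G.nonempty infγ λ g → G.hasLeast g λ (g₀ , isLeast) →
    let a = proj₁ (proj₂ W (inj₂ g₀))
        W₁ = proj₂ (proj₂ W (inj₂ g₀))
        greatest : IsGreatest Y (inj₂ g₀)
        greatest = λ { (inj₂ h) (₂<₂ h<g₀) → isLeast h h<g₀ }
        nothingAbove : IsGreatest α a
        nothingAbove a′ a<a′ = greatest _ (to (orderAgrees (partIsoOf 2 a′ (proj₂ (proj₁ W₁ a′)))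
                                                           (there (here refl)) (here refl)) a<a′)
    in refute (a , λ a′ a<a′ → ⊥-elim (nothingAbove a′ a<a′))

  -- The least such point is a limit: an immediate predecessor p would also have only
  -- successors above it (namely l and the points above l).
  leastIsLimit : ∀ l → SuccessorsAbove α l → (∀ y → _<_ α y l → ¬ SuccessorsAbove α y) →
                 NoPredecessor α l
  leastIsLimit l succAbove minimal p p<l nothingBetween = minimal p p<l succAboveP
    where
    succAboveP : SuccessorsAbove α p
    succAboveP y p<y with A.compare y l
    ... | tri< y<l _ _  = λ _ → nothingBetween (y , p<y , y<l)
    ... | tri≈ _ refl _ = λ refute → refute (p , p<y , nothingBetween)
    ... | tri> _ _ l<y  = succAbove y l<y

  limitInY : ∀ c → NoPredecessor Y (inj₁ (inj₂ (suc c ∷ zeros (suc k))))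
  limitInY c (inj₁ (inj₁ _)) (₁<₁ ₁<₂) refute =
    refute (inj₁ (inj₂ (0 ∷ zeros (suc k))) , ₁<₁ ₁<₂ , ₁<₁ (₂<₂ (inj₁ (s≤s z≤n))))
  limitInY c (inj₁ (inj₂ r)) (₁<₁ (₂<₂ r<v)) refute =
    let (q , r<q , q<v) = lexLimit (suc c) r r<v in refute (inj₁ (inj₂ q) , ₁<₁ (₂<₂ r<q) , ₁<₁ (₂<₂ q<v))

  belowSomeLimit : ∀ u → ∃ λ c → _<_ Y (inj₁ u) (inj₁ (inj₂ (suc c ∷ zeros (suc k))))
  belowSomeLimit (inj₁ _)         = 0 , ₁<₁ ₁<₂
  belowSomeLimit (inj₂ (s₀ ∷ _)) = s₀ , ₁<₁ (₂<₂ (inj₁ (n<1+n s₀)))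

  answerFails : ∀ l → SuccessorsAbove α l → NoPredecessor α l → ∀ y → ¬ IIWins α Y 3 ((l , y) ∷ [])
  answerFails l _ limit (inj₂ h) W₁ =
    covered h λ (_ , cov) → predecessorGap 1 (coveredInY cov) limit (swapWins 3 W₁)
  answerFails l succAbove _ (inj₁ u) W₁ =
    let (c , u<v) = belowSomeLimit u in belowLimit 0 succAbove u<v (limitInY c) W₁

  refuted : ⊥
  refuted = someSuccessorsAbove λ (_ , sa) → A.least (SuccessorsAbove α) sa λ (l , succAbove , minimal) →
    answerFails l succAbove (leastIsLimit l succAbove minimal) (proj₁ (proj₁ W l)) (proj₂ (proj₁ W l))

lemma4p3 : (α β γ : LinOrd) → IsOrdinal α → IsOrdinal β → IsOrdinal γ →
    (m : ℕ) → m > 1 →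
    (Infinite γ → ¬ (α ≡[ 4 ] (β ⊕ ω^ m ⊕ rev γ))) ×
    (Infinite β → ¬ (α ≡[ 4 ] (β ⊕ ω*^ m ⊕ rev γ)))
lemma4p3 α β γ oα _ oγ (suc (suc k)) _ =
  (λ infγ W → PartI.refuted α β γ oα oγ k infγ W) , (λ _ → partII α β γ oα k)
lemma4p3 _ _ _ _ _ _ (suc zero) (s≤s ())
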